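{- The logic $\mathsf{L}_{\mathsf{S}\mathsf{A}}$ is complete for $\mathcal{L}_{\mathsf{S}\mathsf{A}}$ with respect to augmented expertise frames: every formula $\phi\in\mathcal{L}_{\mathsf{S}\mathsf{A}}$ such that $N,x\vDash^{\mathrm{aug}}\phi$ for every augmented model $N$ and every state $x$ of $N$ is a theorem of $\mathsf{L}_{\mathsf{S}\mathsf{A}}$.
   Context: Let $\mathsf{Prop}$ be a countable set of propositional variables and let $\mathcal{L}_{\mathsf{S}\mathsf{A}}$ be the language $\phi ::= p \mid \neg\phi \mid \phi\wedge\phi \mid \mathsf{S}\phi \mid \mathsf{A}\phi$. The logic $\mathsf{L}_{\mathsf{S}\mathsf{A}}$ is classical propositional calculus over $\mathcal{L}_{\mathsf{S}\mathsf{A}}$ extended with axioms $\mathsf{S}\phi\wedge\neg\mathsf{S}\psi\rightarrow\mathsf{S}(\phi\wedge\neg\psi)$; $\phi\rightarrow\mathsf{S}\phi$; $\mathsf{S}\neg\mathsf{S}\phi\rightarrow\neg\mathsf{S}\phi$; $\mathsf{A}(\phi\rightarrow\psi)\rightarrow(\mathsf{A}\phi\rightarrow\mathsf{A}\psi)$; $\mathsf{A}\phi\rightarrow\phi$; $\neg\mathsf{A}\phi\rightarrow\mathsf{A}\neg\mathsf{A}\phi$; $\mathsf{A}\phi\rightarrow\neg\mathsf{S}\neg\phi$; and rules modus ponens, from $\phi$ infer $\mathsf{A}\phi$, and from $\phi\leftrightarrow\psi$ infer $\mathsf{S}\phi\leftrightarrow\mathsf{S}\psi$. An expertise frame is $(X,P)$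 with $P\subseteq 2^X$ satisfying (P1) $X\in P$, (P2) $A\in P\Rightarrow X\setminus A\in P$, (P3) closure under arbitrary intersections. For such $P$, let $R_P$ be the equivalence relation on $X$ given by $xR_Py$ iff $A_x=A_y$, where $A_x=\bigcap\{A\in P\mid x\in A\}$ (equivalently, the unique equivalence relation whose unions of classes are exactly the members of $P$). An augmented expertise frame is $(X,P,R_\mathsf{A})$ where $(X,P)$ is an expertise frame and $R_\mathsf{A}$ is an equivalence relation on $X$ with $R_P\subseteq R_\mathsf{A}$; an augmented model $N=(X,P,R_\mathsf{A},v)$ adds a valuation $v:\mathsf{Prop}\to2^X$. Satisfaction $\vDash^{\mathrm{aug}}$: atoms and Boolean connectives standard; $N,x\vDash^{\mathrm{aug}}\mathsf{S}\phi$ iff for all $A\in P$, $\|\phi\|_N\subseteq A$ implies $x\in A$ (where $\|\phi\|_N=\{y\mid N,y\vDash^{\mathrm{aug}}\phi\}$); $N,x\vDash^{\mathrm{aug}}\mathsf{A}\phi$ iff for all $y\in X$ with $xR_\mathsf{A}y$, $N,y\vDash^{\mathrm{aug}}\phi$. -}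

module Defs where

open import Level using (Level; 0ℓ; Lift) renaming (suc to lsuc)
open import Data.Nat using (ℕ)
open import Data.Bool using (Bool; true; false; not; _∧_)
open import Data.Empty using (⊥)
open import Data.Unit using (⊤)
open import Data.Product using (_×_; _,_)
open import Relation.Binary.PropositionalEquality using (_≡_)
open import Relation.Binary.Core using (Rel)
open import Relation.Binary.Structures using (IsEquivalence)
open import Relation.Unary using (Pred)

data Formula : Set where
  var : ℕ → Formula
  ¬'_ : Formula → Formula
  _∧'_ : Formula → Formula → Formula
  S : Formula → Formula
  A : Formula → Formula

infixr 6 _∧'_
infix 7 ¬'_
infixr 5 _⇒_
infix 4 _⇔'_

_⇒_ : Formula → Formula → Formula
φ ⇒ ψ = ¬' (φ ∧' ¬' ψ)

_⇔'_ : Formula → Formula → Formula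
φ ⇔' ψ = (φ ⇒ ψ) ∧' (ψ ⇒ φ)

-- Classical propositional calculus: all substitution instances of
-- propositional tautologies.  A formula is a tautology instance iff it
-- evaluates to true under every Boolean assignment to its maximal
-- non-Boolean subformulas (atoms, S-formulas, A-formulas).

evalB : (Formula → Bool) → Formula → Bool
evalB f (var p) = f (var p)
evalB f (¬' φ) = not (evalB f φ)
evalB f (φ ∧' ψ) = evalB f φ ∧ evalB f ψ
evalB f (S φ) = f (S φ)
evalB f (A φ) = f (A φ)

Tautology : Formula → Set
Tautology φ = (f : Formula → Bool) → evalB f φ ≡ true

data ⊢_ : Formula → Set where
  taut : ∀ {φ} → Tautology φ → ⊢ φ
  ax-S1 : ∀ φ ψ → ⊢ ((S φ ∧' ¬' S ψ) ⇒ S (φ ∧' ¬' ψ))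
  ax-S2 : ∀ φ → ⊢ (φ ⇒ S φ)
  ax-S3 : ∀ φ → ⊢ (S (¬' S φ) ⇒ ¬' S φ)
  ax-K : ∀ φ ψ → ⊢ (A (φ ⇒ ψ) ⇒ (A φ ⇒ A ψ))
  ax-T : ∀ φ → ⊢ (A φ ⇒ φ)
  ax-5 : ∀ φ → ⊢ (¬' A φ ⇒ A (¬' A φ))
  ax-AS : ∀ φ → ⊢ (A φ ⇒ ¬' S (¬' φ))
  mp : ∀ {φ ψ} → ⊢ (φ ⇒ ψ) → ⊢ φ → ⊢ ψ
  nec : ∀ {φ} → ⊢ φ → ⊢ A φ
  congS : ∀ {φ ψ} → ⊢ (φ ⇔' ψ) → ⊢ (S φ ⇔' S ψ)

infix 3 ⊢_

record ExpertiseFrame (X : Set) : Set₁ where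
  field
    P : Pred X 0ℓ → Set
    -- P is a collection of *sets*: membership respects extensional equality
    P-ext : ∀ {B C : Pred X 0ℓ} → P B → (∀ x → (B x → C x) × (C x → B x)) → P C
    P1 : P (λ _ → ⊤)
    P2 : ∀ {B} → P B → P (λ x → B x → ⊥)
    P3 : (I : Set) (F : I → Pred X 0ℓ) → (∀ i → P (F i)) → P (λ x → ∀ i → F i x)

  Ax : X → Pred X (lsuc 0ℓ)
  Ax x z = ∀ B → P B → B x → B z

  R-P : Rel X (lsuc 0ℓ)
  R-P x y = ∀ z → (Ax x z → Ax y z) × (Ax y z → Ax x z)

record AugFrame (X : Set) : Set₁ where
  field
    frame : ExpertiseFrame X
    R-A : Rel X 0ℓ
    R-A-equiv : IsEquivalence R-A
    R-P⊆R-A : ∀ {x y} → ExpertiseFrame.R-P frame x y → R-A x y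
  open ExpertiseFrame frame public

record AugModel (X : Set) : Set₁ where
  field
    augFrame : AugFrame X
    v : ℕ → Pred X 0ℓ
  open AugFrame augFrame public

_,_⊨_ : {X : Set} → AugModel X → X → Formula → Set₁
N , x ⊨ var p = Lift (lsuc 0ℓ) (AugModel.v N p x)
N , x ⊨ (¬' φ) = N , x ⊨ φ → ⊥
N , x ⊨ (φ ∧' ψ) = (N , x ⊨ φ) × (N , x ⊨ ψ)
N , x ⊨ S φ = ∀ (B : Pred _ 0ℓ) → AugModel.P N B → (∀ y → N , y ⊨ φ → B y) → Lift (lsuc 0ℓ) (B x)
N , x ⊨ A φ = ∀ y → AugModel.R-A N x y → N , y ⊨ φ

infix 3 _,_⊨_

-- Canonical model argument.  The worlds are the maximal consistent theories.
-- S is the dual of an S5 box □S φ = ¬S¬φ, and the expertise sets are the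
-- unions of classes of "agreeing on all □S-formulas"; A is read through
-- agreement on all A-formulas.  Since A φ → □S A φ is a theorem, agreeing on
-- □S-formulas implies agreeing on A-formulas, which gives R_P ⊆ R_A.  The
-- truth lemma then reduces to the existence lemma for an S5 box, proved once
-- for both boxes.  Excluded middle drives the Lindenbaum construction.
module Submission where

open import Defs
open import Axiom.ExcludedMiddle using (ExcludedMiddle)
open import Level using (Level; 0ℓ; lift; lower) renaming (suc to lsuc)
open import Data.Nat using (ℕ; zero; suc; _≤_; _≤′_; ≤′-refl; ≤′-step; _⊔_)
open import Data.Nat.Properties using (≤⇒≤′; m≤m⊔n; m≤n⊔m)
open import Data.Fin using (Fin; zero; suc)
open import Data.Fin.Subset.Properties using (anySubset?)
open import Data.Bool using (Bool; true; false; not; _∧_; T; _≟_)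
open import Data.Bool.Properties using (¬-not)
open import Data.Vec using (Vec; []; _∷_; lookup) renaming (map to mapᵥ)
open import Data.Vec.Properties using (lookup-map)
open import Data.List using (List; []; _∷_; _++_; map; cartesianProductWith)
open import Data.List.Membership.Propositional using (_∈_)
open import Data.List.Membership.Propositional.Properties
  using (∈-++⁺ˡ; ∈-++⁺ʳ; ∈-map⁺; ∈-cartesianProductWith⁺)
open import Data.List.Relation.Unary.All as All using (All; []; _∷_)
open import Data.List.Relation.Unary.All.Properties using (++⁺)
open import Data.List.Relation.Unary.Any using (here; there)
open import Data.Product using (_×_; _,_; proj₁; proj₂; ∃-syntax)
open import Data.Sum using (_⊎_; inj₁; inj₂; [_,_]′)
import Data.Sum as Sum
open import Data.Empty using (⊥-elim)
open import Function using (_∘_)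
open import Function.Bundles using (_⇔_; mk⇔; Equivalence)
open import Function.Construct.Identity using (⇔-id)
open import Function.Construct.Symmetry using (⇔-sym)
open import Function.Construct.Composition using (_⇔-∘_)
open import Data.Product.Function.NonDependent.Propositional using (_×-⇔_)
open import Relation.Nullary using (¬_; Dec; yes; no)
open import Relation.Nullary.Decidable
  using (False; ⌊_⌋; map′; toWitness; fromWitness; toWitnessFalse; decidable-stable)
open import Relation.Unary using (Pred; ∅; ｛_｝; _∪_; _⊆_; ⋃)
open import Relation.Binary.Structures using (IsEquivalence)
open import Relation.Binary.PropositionalEquality using (_≡_; refl; sym; trans; cong; cong₂)

open Equivalence using (to; from)

private
  variable
    a ℓ : Level
    X : Set a
    n m : ℕ
    φ ψ χ θ : Formula

⊤' : Formula
⊤' = var 0 ⇒ var 0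

⊥' : Formula
⊥' = ¬' ⊤'

⋀ : List Formula → Formula
⋀ [] = ⊤'
⋀ (φ ∷ φs) = φ ∧' ⋀ φs

data Schema (n : ℕ) : Set where
  `_ : Fin n → Schema n
  ⊤ₛ : Schema n
  ~_ : Schema n → Schema n
  _&_ : Schema n → Schema n → Schema n

infixr 6 _&_
infix 7 ~_
infixr 5 _⟶_
infix 4 _⟷_

_⟶_ : Schema n → Schema n → Schema n
s ⟶ t = ~ (s & ~ t)

_⟷_ : Schema n → Schema n → Schema n
s ⟷ t = (s ⟶ t) & (t ⟶ s)

⊥ₛ : Schema n
⊥ₛ = ~ ⊤ₛ

p₀ : Schema (suc n)
p₀ = ` zero

p₁ : Schema (suc (suc n))
p₁ = ` suc zero

p₂ : Schema (suc (suc (suc n)))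
p₂ = ` suc (suc zero)

p₃ : Schema (suc (suc (suc (suc n))))
p₃ = ` suc (suc (suc zero))

p₄ : Schema (suc (suc (suc (suc (suc n)))))
p₄ = ` suc (suc (suc (suc zero)))

_⟨_⟩ : Schema n → Vec Formula n → Formula
(` i) ⟨ φs ⟩ = lookup φs i
⊤ₛ ⟨ φs ⟩ = ⊤'
(~ s) ⟨ φs ⟩ = ¬' s ⟨ φs ⟩
(s & t) ⟨ φs ⟩ = s ⟨ φs ⟩ ∧' t ⟨ φs ⟩

eval : Schema n → Vec Bool n → Bool
eval (` i) β = lookup β i
eval ⊤ₛ β = true
eval (~ s) β = not (eval s β)
eval (s & t) β = eval s β ∧ eval t β

evalB-⊤' : (f : Formula → Bool) → evalB f ⊤' ≡ true
evalB-⊤' f with f (var 0)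
... | true = refl
... | false = refl

evalB-⟨⟩ : (f : Formula → Bool) (s : Schema n) (φs : Vec Formula n) →
           evalB f (s ⟨ φs ⟩) ≡ eval s (mapᵥ (evalB f) φs)
evalB-⟨⟩ f (` i) φs = sym (lookup-map i (evalB f) φs)
evalB-⟨⟩ f ⊤ₛ φs = evalB-⊤' f
evalB-⟨⟩ f (~ s) φs = cong not (evalB-⟨⟩ f s φs)
evalB-⟨⟩ f (s & t) φs = cong₂ _∧_ (evalB-⟨⟩ f s φs) (evalB-⟨⟩ f t φs)

-- A subset of Fin n is a vector of n Booleans, so anySubset? searches all assignments.
counterexample? : (s : Schema n) → Dec (∃[ β ] eval s β ≡ false)
counterexample? s = anySubset? (λ β → eval s β ≟ false)

⊢-taut : (s : Schema n) {_ : False (counterexample? s)} (φs : Vec Formula n) → ⊢ s ⟨ φs ⟩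
⊢-taut s {valid} φs =
  taut λ f → trans (evalB-⟨⟩ f s φs) (¬-not λ e → toWitnessFalse valid (_ , e))

⊢⊤' : ⊢ ⊤'
⊢⊤' = ⊢-taut ⊤ₛ []

⇒-trans : ⊢ φ ⇒ ψ → ⊢ ψ ⇒ χ → ⊢ φ ⇒ χ
⇒-trans {φ} {ψ} {χ} d e = mp (mp (⊢-taut ((p₀ ⟶ p₁) ⟶ (p₁ ⟶ p₂) ⟶ p₀ ⟶ p₂) (φ ∷ ψ ∷ χ ∷ [])) d) e

⋀-++ : (φs ψs : List Formula) → ⊢ ⋀ (φs ++ ψs) ⇒ ⋀ φs ∧' ⋀ ψs
⋀-++ [] ψs = ⊢-taut (p₀ ⟶ ⊤ₛ & p₀) (⋀ ψs ∷ [])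
⋀-++ (φ ∷ φs) ψs = mp (⊢-taut ((p₀ ⟶ p₁ & p₂) ⟶ p₃ & p₀ ⟶ (p₃ & p₁) & p₂)
                               (⋀ (φs ++ ψs) ∷ ⋀ φs ∷ ⋀ ψs ∷ φ ∷ []))
                      (⋀-++ φs ψs)

Theory : Set₁
Theory = Pred Formula 0ℓ

infix 4 _⊢ˢ_

_⊢ˢ_ : Theory → Formula → Set
Γ ⊢ˢ φ = ∃[ ψs ] All Γ ψs × ⊢ ⋀ ψs ⇒ φ

Consistent : Theory → Set
Consistent Γ = ¬ (Γ ⊢ˢ ⊥')

module _ {Γ : Theory} where

  ⊢ˢ-assumption : Γ φ → Γ ⊢ˢ φ
  ⊢ˢ-assumption {φ} Γφ = φ ∷ [] , Γφ ∷ [] , ⊢-taut (p₀ & ⊤ₛ ⟶ p₀) (φ ∷ [])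

  ⊢ˢ-implied : ⊢ φ ⇒ ψ → Γ ⊢ˢ φ → Γ ⊢ˢ ψ
  ⊢ˢ-implied d (ψs , Γψs , e) = ψs , Γψs , ⇒-trans e d

  ⊢ˢ-mp : Γ ⊢ˢ φ ⇒ ψ → Γ ⊢ˢ φ → Γ ⊢ˢ ψ
  ⊢ˢ-mp {φ} {ψ} (χs , Γχs , d) (θs , Γθs , e) =
    χs ++ θs , ++⁺ Γχs Γθs ,
    ⇒-trans (⋀-++ χs θs)
            (mp (mp (⊢-taut ((p₀ ⟶ p₂ ⟶ p₃) ⟶ (p₁ ⟶ p₂) ⟶ p₀ & p₁ ⟶ p₃)
                            (⋀ χs ∷ ⋀ θs ∷ φ ∷ ψ ∷ [])) d) e)

  ⊢ˢ-contradiction : Γ ⊢ˢ φ → Γ ⊢ˢ ¬' φ → Γ ⊢ˢ ⊥'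
  ⊢ˢ-contradiction {φ} d = ⊢ˢ-mp (⊢ˢ-implied (⊢-taut (p₀ ⟶ ~ p₀ ⟶ ⊥ₛ) (φ ∷ [])) d)

  ⋀-split : ∀ ψs → All (Γ ∪ ｛ θ ｝) ψs → ∃[ χs ] All Γ χs × ⊢ θ ∧' ⋀ χs ⇒ ⋀ ψs
  ⋀-split {θ} [] [] = [] , [] , ⊢-taut (p₀ & ⊤ₛ ⟶ ⊤ₛ) (θ ∷ [])
  ⋀-split {θ} (ψ ∷ ψs) (inj₁ Γψ ∷ Γθψs) with ⋀-split ψs Γθψs
  ... | χs , Γχs , d = ψ ∷ χs , Γψ ∷ Γχs ,
    mp (⊢-taut ((p₀ & p₁ ⟶ p₂) ⟶ p₀ & p₃ & p₁ ⟶ p₃ & p₂) (θ ∷ ⋀ χs ∷ ⋀ ψs ∷ ψ ∷ [])) d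
  ⋀-split {θ} (ψ ∷ ψs) (inj₂ refl ∷ Γθψs) with ⋀-split ψs Γθψs
  ... | χs , Γχs , d = χs , Γχs ,
    mp (⊢-taut ((p₀ & p₁ ⟶ p₂) ⟶ p₀ & p₁ ⟶ p₀ & p₂) (θ ∷ ⋀ χs ∷ ⋀ ψs ∷ [])) d

  ⊢ˢ-deduction : Γ ∪ ｛ θ ｝ ⊢ˢ φ → Γ ⊢ˢ θ ⇒ φ
  ⊢ˢ-deduction {θ} {φ} (ψs , Γθψs , d) with ⋀-split ψs Γθψs
  ... | χs , Γχs , e = χs , Γχs ,
    mp (mp (⊢-taut ((p₀ & p₁ ⟶ p₂) ⟶ (p₂ ⟶ p₃) ⟶ p₁ ⟶ p₀ ⟶ p₃) (θ ∷ ⋀ χs ∷ ⋀ ψs ∷ φ ∷ [])) e) d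

  ∪-inconsistent : Γ ∪ ｛ θ ｝ ⊢ˢ ⊥' → Γ ⊢ˢ ¬' θ
  ∪-inconsistent {θ} = ⊢ˢ-implied (⊢-taut ((p₀ ⟶ ⊥ₛ) ⟶ ~ p₀) (θ ∷ [])) ∘ ⊢ˢ-deduction

  ∪¬-consistent : ¬ (Γ ⊢ˢ φ) → Consistent (Γ ∪ ｛ ¬' φ ｝)
  ∪¬-consistent {φ} Γ⊬φ = Γ⊬φ ∘ ⊢ˢ-implied (⊢-taut (~ ~ p₀ ⟶ p₀) (φ ∷ [])) ∘ ∪-inconsistent

⊢ˢ-mono : {Γ Δ : Theory} → Γ ⊆ Δ → Γ ⊢ˢ φ → Δ ⊢ˢ φ
⊢ˢ-mono Γ⊆Δ (ψs , Γψs , d) = ψs , All.map Γ⊆Δ Γψs , d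

∅⊢ˢ⇒⊢ : ∅ ⊢ˢ φ → ⊢ φ
∅⊢ˢ⇒⊢ ([] , [] , d) = mp d ⊢⊤'

record IsS5 (□ : Formula → Formula) : Set where
  field
    □-K : ∀ φ ψ → ⊢ □ (φ ⇒ ψ) ⇒ (□ φ ⇒ □ ψ)
    □-nec : ⊢ φ → ⊢ □ φ
    □-T : ∀ φ → ⊢ □ φ ⇒ φ
    □-5 : ∀ φ → ⊢ ¬' □ φ ⇒ □ (¬' □ φ)

  □-mono : ⊢ φ ⇒ ψ → ⊢ □ φ ⇒ □ ψ
  □-mono {φ} {ψ} d = mp (□-K φ ψ) (□-nec d)

  □-4 : ∀ φ → ⊢ □ φ ⇒ □ (□ φ)
  □-4 φ = ⇒-trans (mp (⊢-taut ((p₀ ⟶ ~ p₁) ⟶ p₁ ⟶ ~ p₀) (□ ¬□φ ∷ □ φ ∷ [])) (□-T ¬□φ))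
         (⇒-trans (□-5 ¬□φ)
                  (□-mono (mp (⊢-taut ((~ p₀ ⟶ p₁) ⟶ ~ p₁ ⟶ p₀) (□ φ ∷ □ ¬□φ ∷ [])) (□-5 φ))))
    where
    ¬□φ : Formula
    ¬□φ = ¬' □ φ

  □-∧ : ∀ φ ψ → ⊢ □ φ ⇒ □ ψ ⇒ □ (φ ∧' ψ)
  □-∧ φ ψ = ⇒-trans (□-mono (⊢-taut (p₀ ⟶ p₁ ⟶ p₀ & p₁) (φ ∷ ψ ∷ []))) (□-K ψ (φ ∧' ψ))

  Stable : Formula → Set
  Stable φ = ⊢ φ ⇒ □ φ

  ⋀-stable : ∀ {φs} → All Stable φs → Stable (⋀ φs)
  ⋀-stable [] = mp (⊢-taut (p₀ ⟶ ⊤ₛ ⟶ p₀) (□ ⊤' ∷ [])) (□-nec ⊢⊤')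
  ⋀-stable {φ ∷ φs} (d ∷ ds) =
    mp (mp (mp (⊢-taut ((p₀ ⟶ p₂) ⟶ (p₁ ⟶ p₃) ⟶ (p₂ ⟶ p₃ ⟶ p₄) ⟶ p₀ & p₁ ⟶ p₄)
                       (φ ∷ ⋀ φs ∷ □ φ ∷ □ (⋀ φs) ∷ □ (φ ∧' ⋀ φs) ∷ []))
               d) (⋀-stable ds)) (□-∧ φ (⋀ φs))

  ⊢ˢ-□ : {Γ : Theory} → (∀ {ψ} → Γ ψ → Stable ψ) → Γ ⊢ˢ φ → Γ ⊢ˢ □ φ
  ⊢ˢ-□ stable (ψs , Γψs , d) = ψs , Γψs , ⇒-trans (⋀-stable (All.map stable Γψs)) (□-mono d)

isS5-A : IsS5 A
isS5-A = record { □-K = ax-K ; □-nec = nec ; □-T = ax-T ; □-5 = ax-5 }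

□S : Formula → Formula
□S φ = ¬' S (¬' φ)

S-cong : ⊢ φ ⇔' ψ → ⊢ S φ ⇒ S ψ
S-cong {φ} {ψ} d = mp (⊢-taut ((p₀ ⟷ p₁) ⟶ p₀ ⟶ p₁) (S φ ∷ S ψ ∷ [])) (congS d)

⊢S⊤' : ⊢ S ⊤'
⊢S⊤' = mp (ax-S2 ⊤') ⊢⊤'

-- S3 at ⊤ gives ¬S¬S⊤, and ¬S⊤ is equivalent to ⊥ because S⊤ is a theorem.
⊢¬S⊥' : ⊢ ¬' S ⊥'
⊢¬S⊥' = mp (mp (mp (⊢-taut ((p₀ ⟷ p₁) ⟶ (p₀ ⟶ ~ p₂) ⟶ p₂ ⟶ ~ p₁)
                            (S (¬' S ⊤') ∷ S ⊥' ∷ S ⊤' ∷ []))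
                   (congS (mp (⊢-taut (p₀ ⟶ (~ p₀ ⟷ ⊥ₛ)) (S ⊤' ∷ [])) ⊢S⊤')))
               (ax-S3 ⊤'))
           ⊢S⊤'

□S-K : ∀ φ ψ → ⊢ □S (φ ⇒ ψ) ⇒ (□S φ ⇒ □S ψ)
□S-K φ ψ =
  mp (⊢-taut ((p₀ & ~ p₁ ⟶ p₂) ⟶ ~ p₂ ⟶ ~ p₁ ⟶ ~ p₀) (S (¬' ψ) ∷ S (¬' φ) ∷ S (¬' (φ ⇒ ψ)) ∷ []))
     (⇒-trans (ax-S1 (¬' ψ) (¬' φ))
              (S-cong (⊢-taut (~ p₁ & ~ ~ p₀ ⟷ ~ (p₀ ⟶ p₁)) (φ ∷ ψ ∷ []))))

□S-nec : ⊢ φ → ⊢ □S φ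
□S-nec {φ} d = mp (mp (⊢-taut ((p₀ ⟶ p₁) ⟶ ~ p₁ ⟶ ~ p₀) (S (¬' φ) ∷ S ⊥' ∷ []))
                      (S-cong (mp (⊢-taut (p₀ ⟶ (~ p₀ ⟷ ⊥ₛ)) (φ ∷ [])) d)))
                  ⊢¬S⊥'

□S-T : ∀ φ → ⊢ □S φ ⇒ φ
□S-T φ = mp (⊢-taut ((~ p₀ ⟶ p₁) ⟶ ~ p₁ ⟶ p₀) (φ ∷ S (¬' φ) ∷ [])) (ax-S2 (¬' φ))

□S-5 : ∀ φ → ⊢ ¬' □S φ ⇒ □S (¬' □S φ)
□S-5 φ = mp (⊢-taut ((p₁ ⟶ ~ p₀) ⟶ ~ ~ p₀ ⟶ ~ p₁) (S (¬' φ) ∷ S (¬' ¬' ¬' S (¬' φ)) ∷ []))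
            (⇒-trans (S-cong (⊢-taut (~ ~ p₀ ⟷ p₀) (¬' S (¬' φ) ∷ []))) (ax-S3 (¬' φ)))

isS5-□S : IsS5 □S
isS5-□S = record { □-K = □S-K ; □-nec = □S-nec ; □-T = □S-T ; □-5 = □S-5 }

S⇒¬□S¬ : ⊢ S φ ⇒ ¬' □S (¬' φ)
S⇒¬□S¬ {φ} = ⇒-trans (S-cong (⊢-taut (p₀ ⟷ ~ ~ p₀) (φ ∷ [])))
                      (⊢-taut (p₀ ⟶ ~ ~ p₀) (S (¬' ¬' φ) ∷ []))

¬□S¬⇒S : ⊢ ¬' □S (¬' φ) ⇒ S φ
¬□S¬⇒S {φ} = ⇒-trans (⊢-taut (~ ~ p₀ ⟶ p₀) (S (¬' ¬' φ) ∷ []))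
                      (S-cong (⊢-taut (~ ~ p₀ ⟷ p₀) (φ ∷ [])))

A⇒□SA : ⊢ A φ ⇒ □S (A φ)
A⇒□SA {φ} = ⇒-trans (IsS5.□-4 isS5-A φ) (ax-AS (A φ))

-- Given by its Boolean characteristic function, so that World lives in Set.
record World : Set where
  field
    holds : Formula → Bool
    consistent : Consistent (T ∘ holds)
    complete : ∀ φ → T (holds φ) ⊎ T (holds (¬' φ))

infix 4 _∋_

-- A record rather than T (holds w φ), so that w can be inferred from w ∋ φ.
record _∋_ (w : World) (φ : Formula) : Set where
  constructor member
  field
    holds-true : T (World.holds w φ)

open _∋_

module _ (w : World) where

  ∋-consistent : Consistent (w ∋_)
  ∋-consistent = World.consistent w ∘ ⊢ˢ-mono holds-true

  ∋-complete : ∀ φ → w ∋ φ ⊎ w ∋ ¬' φ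
  ∋-complete φ = Sum.map member member (World.complete w φ)

  ∋-closed : (w ∋_) ⊢ˢ φ → w ∋ φ
  ∋-closed {φ} d = [ (λ ∋φ → ∋φ) , ⊥-elim ∘ ∋-consistent ∘ ⊢ˢ-contradiction d ∘ ⊢ˢ-assumption ]′
                     (∋-complete φ)

  ∋-mp : ⊢ φ ⇒ ψ → w ∋ φ → w ∋ ψ
  ∋-mp d = ∋-closed ∘ ⊢ˢ-implied d ∘ ⊢ˢ-assumption

  ∋¬⇒∌ : w ∋ ¬' φ → ¬ (w ∋ φ)
  ∋¬⇒∌ ∋¬φ ∋φ = ∋-consistent (⊢ˢ-contradiction (⊢ˢ-assumption ∋φ) (⊢ˢ-assumption ∋¬φ))

  ∌⇒∋¬ : ¬ (w ∋ φ) → w ∋ ¬' φ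
  ∌⇒∋¬ {φ} ∌φ = [ ⊥-elim ∘ ∌φ , (λ p → p) ]′ (∋-complete φ)

  ∋-stable : ¬ ¬ (w ∋ φ) → w ∋ φ
  ∋-stable {φ} ¬∌φ = [ (λ p → p) , ⊥-elim ∘ ¬∌φ ∘ ∋¬⇒∌ ]′ (∋-complete φ)

  ∋-∧ : w ∋ φ ∧' ψ ⇔ (w ∋ φ × w ∋ ψ)
  ∋-∧ {φ} {ψ} = mk⇔
    (λ ∋φψ → ∋-mp (⊢-taut (p₀ & p₁ ⟶ p₀) (φ ∷ ψ ∷ [])) ∋φψ ,
             ∋-mp (⊢-taut (p₀ & p₁ ⟶ p₁) (φ ∷ ψ ∷ [])) ∋φψ)
    (λ (∋φ , ∋ψ) → ∋-closed (⊢ˢ-mp (⊢ˢ-implied (⊢-taut (p₀ ⟶ p₁ ⟶ p₀ & p₁) (φ ∷ ψ ∷ []))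
                                                (⊢ˢ-assumption ∋φ))
                                   (⊢ˢ-assumption ∋ψ)))

  ∋S⇔∌□S¬ : w ∋ S φ ⇔ (¬ w ∋ □S (¬' φ))
  ∋S⇔∌□S¬ = mk⇔ (∋¬⇒∌ ∘ ∋-mp S⇒¬□S¬) (∋-mp ¬□S¬⇒S ∘ ∌⇒∋¬)

infix 4 _≈[_]_

_≈[_]_ : World → (Formula → Formula) → World → Set
w ≈[ □ ] u = ∀ φ → w ∋ □ φ ⇔ u ∋ □ φ

≈-isEquivalence : (□ : Formula → Formula) → IsEquivalence (_≈[ □ ]_)
≈-isEquivalence □ = record
  { refl = λ φ → ⇔-id _
  ; sym = λ w≈u φ → ⇔-sym (w≈u φ)
  ; trans = λ w≈u u≈v φ → (u≈v φ) ⇔-∘ (w≈u φ)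
  }

≈□S⇒≈A : ∀ {w u} → w ≈[ □S ] u → w ≈[ A ] u
≈□S⇒≈A {w} {u} w≈u φ = ⇔-sym (A⇔□SA u) ⇔-∘ (w≈u (A φ) ⇔-∘ A⇔□SA w)
  where
  A⇔□SA : ∀ v → v ∋ A φ ⇔ v ∋ □S (A φ)
  A⇔□SA v = mk⇔ (∋-mp v A⇒□SA) (∋-mp v (□S-T (A φ)))

module _ {F : ℕ → Pred X ℓ} (increasing : ∀ k → F k ⊆ F (suc k)) where

  chain-mono : m ≤ n → F m ⊆ F n
  chain-mono = go ∘ ≤⇒≤′
    where
    go : m ≤′ n → F m ⊆ F n
    go ≤′-refl p = p
    go (≤′-step m≤′n) p = increasing _ (go m≤′n p)

  All-⋃ : ∀ {xs} → All (⋃ ℕ F) xs → ∃[ k ] All (F k) xs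
  All-⋃ [] = 0 , []
  All-⋃ ((k , p) ∷ ps) with All-⋃ ps
  ... | l , qs = k ⊔ l , chain-mono (m≤m⊔n k l) p ∷ All.map (chain-mono (m≤n⊔m k l)) qs

⋃-consistent : (Γ : ℕ → Theory) → (∀ k → Γ k ⊆ Γ (suc k)) → (∀ k → Consistent (Γ k)) →
               Consistent (⋃ ℕ Γ)
⋃-consistent Γ increasing consistent (ψs , Γψs , d) with All-⋃ increasing Γψs
... | k , Γₖψs = consistent k (ψs , Γₖψs , d)

formulas : ℕ → List Formula
formulas zero = []
formulas (suc k) = F ++ var k ∷ map ¬'_ F ++ map S F ++ map A F ++ cartesianProductWith _∧'_ F F
  where
  F : List Formula
  F = formulas k

formulas-mono : m ≤ n → φ ∈ formulas m → φ ∈ formulas n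
formulas-mono m≤n = chain-mono {F = λ k → _∈ formulas k} (λ _ → ∈-++⁺ˡ) m≤n

formulas-complete : ∀ φ → ∃[ k ] φ ∈ formulas k
formulas-complete (var n) = suc n , ∈-++⁺ʳ (formulas n) (here refl)
formulas-complete (¬' φ) with formulas-complete φ
... | k , p = suc k , ∈-++⁺ʳ (formulas k) (there (∈-++⁺ˡ (∈-map⁺ ¬'_ p)))
formulas-complete (S φ) with formulas-complete φ
... | k , p = suc k , ∈-++⁺ʳ (formulas k) (there (∈-++⁺ʳ (map ¬'_ (formulas k))
                        (∈-++⁺ˡ (∈-map⁺ S p))))
formulas-complete (A φ) with formulas-complete φ
... | k , p = suc k , ∈-++⁺ʳ (formulas k) (there (∈-++⁺ʳ (map ¬'_ (formulas k))
                        (∈-++⁺ʳ (map S (formulas k)) (∈-++⁺ˡ (∈-map⁺ A p)))))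
formulas-complete (φ ∧' ψ) with formulas-complete φ | formulas-complete ψ
... | k , p | l , q = suc (k ⊔ l) , ∈-++⁺ʳ (formulas (k ⊔ l)) (there (∈-++⁺ʳ (map ¬'_ F)
                        (∈-++⁺ʳ (map S F) (∈-++⁺ʳ (map A F)
                          (∈-cartesianProductWith⁺ _∧'_ (formulas-mono (m≤m⊔n k l) p)
                                                          (formulas-mono (m≤n⊔m k l) q))))))
  where
  F : List Formula
  F = formulas (k ⊔ l)

module Lindenbaum (em : ExcludedMiddle (lsuc 0ℓ)) where

  decide : (P : Set) → Dec P
  decide P = map′ lower lift em

  decision : Theory → Formula → Formula
  decision Γ θ with decide (Γ ⊢ˢ ¬' θ)
  ... | yes _ = ¬' θ
  ... | no _ = θ

  decision-consistent : ∀ {Γ} θ → Consistent Γ → Consistent (Γ ∪ ｛ decision Γ θ ｝)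
  decision-consistent {Γ} θ con with decide (Γ ⊢ˢ ¬' θ)
  ... | yes Γ⊢¬θ = con ∘ ⊢ˢ-contradiction Γ⊢¬θ ∘ ∪-inconsistent
  ... | no Γ⊬¬θ = Γ⊬¬θ ∘ ∪-inconsistent

  decision-decides : ∀ Γ θ → decision Γ θ ≡ θ ⊎ decision Γ θ ≡ ¬' θ
  decision-decides Γ θ with decide (Γ ⊢ˢ ¬' θ)
  ... | yes _ = inj₂ refl
  ... | no _ = inj₁ refl

  extend : Theory → List Formula → Theory
  extend Γ [] = Γ
  extend Γ (θ ∷ θs) = extend (Γ ∪ ｛ decision Γ θ ｝) θs

  extend-⊇ : ∀ {Γ} θs → Γ ⊆ extend Γ θs
  extend-⊇ [] p = p
  extend-⊇ (θ ∷ θs) p = extend-⊇ θs (inj₁ p)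

  extend-consistent : ∀ {Γ} θs → Consistent Γ → Consistent (extend Γ θs)
  extend-consistent [] con = con
  extend-consistent (θ ∷ θs) con = extend-consistent θs (decision-consistent θ con)

  extend-decides : ∀ {Γ θs} → θ ∈ θs → extend Γ θs θ ⊎ extend Γ θs (¬' θ)
  extend-decides {Γ = Γ} {θ ∷ θs} (here refl) =
    Sum.map (extend-⊇ θs ∘ inj₂) (extend-⊇ θs ∘ inj₂) (decision-decides Γ θ)
  extend-decides {θs = _ ∷ θs} (there p) = extend-decides {θs = θs} p

  module _ (Γ : Theory) where

    stage : ℕ → Theory
    stage zero = Γ
    stage (suc k) = extend (stage k) (formulas k)

    limit-complete : ∀ φ → ⋃ ℕ stage φ ⊎ ⋃ ℕ stage (¬' φ)
    limit-complete φ with formulas-complete φ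
    ... | k , p = Sum.map (suc k ,_) (suc k ,_) (extend-decides p)

  lindenbaum : ∀ {Γ} → Consistent Γ → ∃[ w ] Γ ⊆ (w ∋_)
  lindenbaum {Γ} con = w , λ p → member (fromWitness (0 , p))
    where
    limit : Theory
    limit = ⋃ ℕ (stage Γ)

    limit-consistent : Consistent limit
    limit-consistent = ⋃-consistent (stage Γ) (λ k → extend-⊇ (formulas k)) stage-consistent
      where
      stage-consistent : ∀ k → Consistent (stage Γ k)
      stage-consistent zero = con
      stage-consistent (suc k) = extend-consistent (formulas k) (stage-consistent k)

    w : World
    w = record
      { holds = λ φ → ⌊ decide (limit φ) ⌋
      ; consistent = limit-consistent ∘ ⊢ˢ-mono (λ {φ} → toWitness {a? = decide (limit φ)})
      ; complete = Sum.map fromWitness fromWitness ∘ limit-complete Γ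
      }

module Canonical (em : ExcludedMiddle (lsuc 0ℓ)) where
  open Lindenbaum em

  data IsLiteral (□ : Formula → Formula) : Formula → Set where
    boxed : IsLiteral □ (□ φ)
    unboxed : IsLiteral □ (¬' □ φ)

  -- The theory of □-literals of w: all of them are □-stable, so whatever they
  -- derive is boxed in w.
  existence : ∀ {□ w} → IsS5 □ → ¬ w ∋ □ φ → ∃[ u ] w ≈[ □ ] u × ¬ u ∋ φ
  existence {φ} {□} {w} s5 w∌□φ with lindenbaum (∪¬-consistent literals⊬φ)
    where
    open IsS5 s5
    literals : Theory
    literals ψ = IsLiteral □ ψ × w ∋ ψ

    literal-stable : ∀ {ψ} → literals ψ → Stable ψ
    literal-stable (boxed {χ} , _) = □-4 χ
    literal-stable (unboxed {χ} , _) = □-5 χ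

    literals⊬φ : ¬ literals ⊢ˢ φ
    literals⊬φ = w∌□φ ∘ ∋-closed w ∘ ⊢ˢ-mono proj₂ ∘ ⊢ˢ-□ literal-stable
  ... | u , ⊆u = u , agree , ∋¬⇒∌ u (⊆u (inj₂ refl))
    where
    agree : w ≈[ □ ] u
    agree χ = mk⇔ (λ w∋□χ → ⊆u (inj₁ (boxed , w∋□χ)))
                  (λ u∋□χ → ∋-stable w λ w∌□χ → ∋¬⇒∌ u (⊆u (inj₁ (unboxed , ∌⇒∋¬ w w∌□χ))) u∋□χ)

  Closed : Pred World 0ℓ → Set
  Closed B = ∀ {w u} → w ≈[ □S ] u → B w → B u

  canonicalFrame : ExpertiseFrame World
  canonicalFrame = record
    { P = Closed
    ; P-ext = λ closed B⇔C w≈u Cw → proj₁ (B⇔C _) (closed w≈u (proj₂ (B⇔C _) Cw))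
    ; P1 = λ _ _ → _
    ; P2 = λ closed w≈u ∉B ∈B → ∉B (closed (IsEquivalence.sym (≈-isEquivalence □S) w≈u) ∈B)
    ; P3 = λ I F closed w≈u ∈F i → closed i w≈u (∈F i)
    }

  -- The □S-class of x belongs to P and contains x, hence contains y.
  R-P⊆≈A : ∀ {x y} → ExpertiseFrame.R-P canonicalFrame x y → x ≈[ A ] y
  R-P⊆≈A {x} {y} xRy = ≈□S⇒≈A (y∈Aₓ (x ≈[ □S ]_) (λ w≈u x≈w → ≈.trans x≈w w≈u) ≈.refl)
    where
    module ≈ = IsEquivalence (≈-isEquivalence □S)
    y∈Aₓ : ExpertiseFrame.Ax canonicalFrame x y
    y∈Aₓ = proj₂ (xRy y) (λ _ _ y∈B → y∈B)

  canonicalModel : AugModel World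
  canonicalModel = record
    { augFrame = record
      { frame = canonicalFrame
      ; R-A = _≈[ A ]_
      ; R-A-equiv = ≈-isEquivalence A
      ; R-P⊆R-A = R-P⊆≈A
      }
    ; v = λ p w → w ∋ var p
    }

  truth : ∀ φ w → (canonicalModel , w ⊨ φ) ⇔ w ∋ φ
  truth (var p) w = mk⇔ lower lift
  truth (¬' φ) w = mk⇔ (λ ⊭φ → ∌⇒∋¬ w (⊭φ ∘ from (truth φ w)))
                       (λ ∋¬φ → ∋¬⇒∌ w ∋¬φ ∘ to (truth φ w))
  truth (φ ∧' ψ) w = ⇔-sym (∋-∧ w) ⇔-∘ (truth φ w ×-⇔ truth ψ w)
  truth (S φ) w = mk⇔ ⊨S⇒∋S ∋S⇒⊨S
    where
    ∋S-closed : Closed (_∋ S φ)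
    ∋S-closed {u} {v} u≈v = from (∋S⇔∌□S¬ v) ∘ (_∘ from (u≈v (¬' φ))) ∘ to (∋S⇔∌□S¬ u)

    ⊨S⇒∋S : canonicalModel , w ⊨ S φ → w ∋ S φ
    ⊨S⇒∋S ⊨Sφ = lower (⊨Sφ (_∋ S φ) ∋S-closed λ u → ∋-mp u (ax-S2 φ) ∘ to (truth φ u))

    ∋S⇒⊨S : w ∋ S φ → canonicalModel , w ⊨ S φ
    ∋S⇒⊨S ∋Sφ B B-closed ‖φ‖⊆B with existence isS5-□S (to (∋S⇔∌□S¬ w) ∋Sφ)
    ... | u , w≈u , u∌¬φ = lift (B-closed (IsEquivalence.sym (≈-isEquivalence □S) w≈u)
                                          (‖φ‖⊆B u (from (truth φ u) (∋-stable u (u∌¬φ ∘ ∌⇒∋¬ u)))))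
  truth (A φ) w = mk⇔ ⊨A⇒∋A ∋A⇒⊨A
    where
    ⊨A⇒∋A : canonicalModel , w ⊨ A φ → w ∋ A φ
    ⊨A⇒∋A ⊨Aφ = ∋-stable w λ w∌Aφ →
      let u , w≈u , u∌φ = existence isS5-A w∌Aφ in u∌φ (to (truth φ u) (⊨Aφ u w≈u))

    ∋A⇒⊨A : w ∋ A φ → canonicalModel , w ⊨ A φ
    ∋A⇒⊨A ∋Aφ u w≈u = from (truth φ u) (∋-mp u (ax-T φ) (to (w≈u φ) ∋Aφ))

lemma3 : ExcludedMiddle (lsuc 0ℓ) →
         (φ : Formula) →
         ((X : Set) (N : AugModel X) (x : X) → N , x ⊨ φ) →
         ⊢ φ
lemma3 em φ valid = decidable-stable (decide (⊢ φ)) λ ⊬φ →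
  let w , ⊆w = lindenbaum (∪¬-consistent (⊬φ ∘ ∅⊢ˢ⇒⊢)) in
  ∋¬⇒∌ w (⊆w (inj₂ refl)) (to (truth φ w) (valid World canonicalModel w))
  where
  open Lindenbaum em
  open Canonical em
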